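{- Let $k\ge0$ and $N\ge1$ be integers. The PLRS generated by the $k+2$ coefficients $[1,\underbrace{0,\ldots,0}_{k},N]$ is complete if and only if $1\le N\le \left\lceil (k+2)(k+3)/4\right\rceil$.
   Context: A positive linear recurrence sequence (PLRS) generated by coefficients $[c_1,\ldots,c_L]$ (with $L\ge1$, $c_i$ nonnegative integers, $c_1>0$, $c_L>0$) is the sequence $\{H_n\}_{n\ge1}$ defined by $H_1=1$; for $1\le n<L$, $H_{n+1}=c_1H_n+c_2H_{n-1}+\cdots+c_nH_1+1$; and for $n\ge L$, $H_{n+1}=c_1H_n+\cdots+c_LH_{n+1-L}$. A sequence of positive integers is complete if every positive integer is a sum of distinct terms of the sequence. -}

module Defs where

open import Data.Nat using (ℕ; zero; suc; _+_; _*_; _<ᵇ_; _≤_; _/_)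
open import Data.Bool using (if_then_else_)
open import Data.List using (List; []; _∷_; length; zipWith; map; replicate)
open import Data.Nat.ListAction using (sum)
open import Data.List.Relation.Unary.All using (All)
open import Data.List.Relation.Unary.Unique.Propositional using (Unique)
open import Data.Product using (∃; _×_)
open import Relation.Binary.PropositionalEquality using (_≡_)

-- Given coefficients cs = [c₁,…,c_L] and the list prev = [H_n, H_{n-1}, …, H_1]
-- (most recent first), compute H_{n+1}:
--   n = 0      : H₁ = 1
--   1 ≤ n < L  : c₁H_n + … + c_nH₁ + 1
--   n ≥ L      : c₁H_n + … + c_LH_{n+1-L}
-- (zipWith truncates to the shorter list, giving exactly the right range).
nextTerm : List ℕ → List ℕ → ℕ
nextTerm cs []         = 1
nextTerm cs prev@(_ ∷ _) =
  sum (zipWith _*_ cs prev) + (if length prev <ᵇ length cs then 1 else 0)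

firstTerms : List ℕ → ℕ → List ℕ
firstTerms cs zero    = []
firstTerms cs (suc n) = nextTerm cs (firstTerms cs n) ∷ firstTerms cs n

-- The PLRS generated by cs, 1-indexed: PLRS cs n = H_n for n ≥ 1
-- (the value at index 0 is a dummy 0 and is never used).
PLRS : List ℕ → ℕ → ℕ
PLRS cs zero    = 0
PLRS cs (suc n) = nextTerm cs (firstTerms cs n)

Complete : (ℕ → ℕ) → Set
Complete H = ∀ (m : ℕ) → 1 ≤ m →
  ∃ λ (is : List ℕ) → All (λ i → 1 ≤ i) is × Unique is × sum (map H is) ≡ m

coeffs : ℕ → ℕ → List ℕ
coeffs k N = 1 ∷ (replicate k 0 Data.List.++ (N ∷ []))

ceil4 : ℕ → ℕ
ceil4 a = (a + 3) / 4

-- Brown's criterion: a nondecreasing sequence of positive integers is complete iff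
-- H (n + 1) ≤ 1 + S n for every n, where S n = H₁ + ⋯ + Hₙ.  For the coefficients
-- [1, 0, …, 0, N] of length K = k + 2 one has H i = i for i ≤ K and H (K + j) = K + N S j.
-- At n = K + 1 the criterion reads 2N ≤ 1 + S K = 1 + K (K + 1) / 2, which is the bound on N.
-- Conversely, via H (K + m) = H (K + m - 1) + N H m, the criterion at n = K + m - 1 becomes
-- N H m ≤ 1 + S (m + k), and this bound propagates along the recurrence: with slack 1 when
-- N ≤ K, and without slack when N > K (which forces k ≥ 2), except at m = 2, so that
-- m = K + 2 is checked by hand.

module Submission where

open import Defs
open import Data.Bool using (true; false; if_then_else_)
open import Data.List using ([]; _∷_; length; map; filter; replicate; zipWith; _++_)
open import Data.List.Properties using (filter-accept; filter-reject; filter-all)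
open import Data.List.Relation.Unary.All as All using (All; []; _∷_)
import Data.List.Relation.Unary.All.Properties as Allₚ
open import Data.List.Relation.Unary.AllPairs using ([]; _∷_)
open import Data.List.Relation.Unary.Any as Any using (Any; here; there)
import Data.List.Relation.Unary.Any.Properties as Anyₚ
open import Data.List.Relation.Unary.Unique.Propositional using (Unique)
import Data.List.Relation.Unary.Unique.Propositional.Properties as Uniqueₚ
open import Data.Nat using (ℕ; zero; suc; _+_; _*_; _∸_; _≤_; _<_; _≤?_; _≟_; _<ᵇ_; z≤n; s≤s; z<s)
open import Data.Nat.DivMod using (m*n/n≡m; /-monoˡ-≤; m/n*n≤m)
open import Data.Nat.Induction using (<-rec)
open import Data.Nat.ListAction using (sum)
open import Data.Nat.Properties
open import Data.Nat.Tactic.RingSolver using (solve-∀)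
open import Data.Product using (∃; _×_; _,_; proj₁; proj₂; map₂)
open import Data.Sum using (_⊎_; inj₁; inj₂)
open import Function.Bundles using (_⇔_; mk⇔; Equivalence)
import Function.Properties.Equivalence as ⇔
open import Relation.Binary.PropositionalEquality
open import Relation.Nullary using (yes; no; contradiction)
open import Relation.Nullary.Decidable using (from-no)

partialSum : (ℕ → ℕ) → ℕ → ℕ
partialSum H zero    = 0
partialSum H (suc n) = partialSum H n + H (suc n)

Brown : (ℕ → ℕ) → Set
Brown H = ∀ n → H (suc n) ≤ suc (partialSum H n)

stepwise-mono : (f : ℕ → ℕ) → (∀ n → f n ≤ f (suc n)) → ∀ {m n} → m ≤ n → f m ≤ f n
stepwise-mono f step {n = zero}  z≤n   = ≤-refl
stepwise-mono f step {n = suc n} m≤1+n with m≤n⇒m<n∨m≡n m≤1+n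
... | inj₁ (s≤s m≤n) = ≤-trans (stepwise-mono f step m≤n) (step n)
... | inj₂ refl      = ≤-refl

partialSum-mono : ∀ H {m n} → m ≤ n → partialSum H m ≤ partialSum H n
partialSum-mono H = stepwise-mono (partialSum H) (λ n → m≤m+n (partialSum H n) (H (suc n)))

m+m≤1+[n+n]⇒m≤n : ∀ {m n} → m + m ≤ suc (n + n) → m ≤ n
m+m≤1+[n+n]⇒m≤n {n = n} m+m≤1+2n = ≮⇒≥ λ n<m →
  1+n≰n (≤-trans (≤-reflexive (cong suc (sym (+-suc n n)))) (≤-trans (+-mono-≤ n<m n<m) m+m≤1+2n))

≤⊎≡+suc : ∀ K m → m ≤ K ⊎ ∃ λ d → m ≡ K + suc d
≤⊎≡+suc zero    zero    = inj₁ z≤n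
≤⊎≡+suc zero    (suc m) = inj₂ (m , refl)
≤⊎≡+suc (suc K) zero    = inj₁ z≤n
≤⊎≡+suc (suc K) (suc m) with ≤⊎≡+suc K m
... | inj₁ m≤K           = inj₁ (s≤s m≤K)
... | inj₂ (d , m≡K+1+d) = inj₂ (d , cong suc m≡K+1+d)

lagged-induction : (L : ℕ) (P : ℕ → Set) →
  (∀ m → m ≤ suc L → P m) →
  (∀ j → P (suc L + j) → P (suc j) → P (suc L + suc j)) →
  ∀ m → P m
lagged-induction L P initial step = <-rec P go
  where
    go : ∀ m → (∀ {i} → i < m → P i) → P m
    go m rec with ≤⊎≡+suc (suc L) m
    ... | inj₁ m≤1+L      = initial m m≤1+L
    ... | inj₂ (j , refl) = step j (rec (+-monoʳ-< (suc L) (n<1+n j))) (rec (m<n+m (suc j) z<s))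

≤ceil4-double⇔ : ∀ N X → N ≤ ceil4 (X + X) ⇔ N + N ≤ suc X
≤ceil4-double⇔ N X = mk⇔
  (λ N≤⌈X/2⌉ → m+m≤1+[n+n]⇒m≤n (begin
    (N + N) + (N + N)      ≡⟨ quadruple N ⟩
    N * 4                  ≤⟨ *-monoˡ-≤ 4 N≤⌈X/2⌉ ⟩
    ceil4 (X + X) * 4      ≤⟨ m/n*n≤m (X + X + 3) 4 ⟩
    X + X + 3              ≡⟨ [2X+3]≡1+[1+X+1+X] X ⟩
    suc (suc X + suc X)    ∎))
  (λ 2N≤1+X → ≤-trans (≤-reflexive (sym (m*n/n≡m N 4))) (/-monoˡ-≤ 4 (begin
    N * 4                  ≡⟨ quadruple N ⟨
    (N + N) + (N + N)      ≤⟨ +-mono-≤ 2N≤1+X 2N≤1+X ⟩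
    suc X + suc X          ≤⟨ n≤1+n _ ⟩
    suc (suc X + suc X)    ≡⟨ [2X+3]≡1+[1+X+1+X] X ⟨
    X + X + 3              ∎)))
  where
    open ≤-Reasoning
    quadruple : ∀ N → (N + N) + (N + N) ≡ N * 4
    quadruple = solve-∀
    [2X+3]≡1+[1+X+1+X] : ∀ X → X + X + 3 ≡ suc (suc X + suc X)
    [2X+3]≡1+[1+X+1+X] = solve-∀

Any≤⇒≤sum : ∀ {x xs} → Any (x ≤_) xs → x ≤ sum xs
Any≤⇒≤sum (here x≤y)            = ≤-trans x≤y (m≤m+n _ _)
Any≤⇒≤sum {xs = y ∷ _} (there p) = ≤-trans (Any≤⇒≤sum p) (m≤n+m _ y)

module _ (H : ℕ → ℕ) where

  private
    S : ℕ → ℕ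
    S = partialSum H

  DistinctSum : ℕ → ℕ → Set
  DistinctSum n m = ∃ λ is → All (λ i → 1 ≤ i × i ≤ n) is × Unique is × sum (map H is) ≡ m

  distinctSum-weaken : ∀ {n m} → DistinctSum n m → DistinctSum (suc n) m
  distinctSum-weaken (is , range , distinct , sum≡) =
    is , All.map (map₂ m≤n⇒m≤1+n) range , distinct , sum≡

  distinctSum-addTop : ∀ {n m} → DistinctSum n m → DistinctSum (suc n) (H (suc n) + m)
  distinctSum-addTop {n} (is , range , distinct , sum≡) =
    suc n ∷ is ,
    (s≤s z≤n , ≤-refl) ∷ All.map (map₂ m≤n⇒m≤1+n) range ,
    All.map (λ (_ , i≤n) 1+n≡i → 1+n≰n (subst (_≤ n) (sym 1+n≡i) i≤n)) range ∷ distinct ,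
    cong (H (suc n) +_) sum≡

  -- Greedy: if m exceeds S n, then taking H (1 + n) leaves a remainder of at most S n.
  brown⇒distinctSum : Brown H → ∀ n m → m ≤ S n → DistinctSum n m
  brown⇒distinctSum brown zero    m m≤0 = [] , [] , [] , sym (n≤0⇒n≡0 m≤0)
  brown⇒distinctSum brown (suc n) m m≤S with m ≤? S n
  ... | yes m≤Sn = distinctSum-weaken (brown⇒distinctSum brown n m m≤Sn)
  ... | no  m≰Sn = subst (DistinctSum (suc n)) (m+[n∸m]≡n top≤m)
                     (distinctSum-addTop (brown⇒distinctSum brown n (m ∸ H (suc n)) rest≤Sn))
    where
      top≤m : H (suc n) ≤ m
      top≤m = ≤-trans (brown n) (≰⇒> m≰Sn)
      rest≤Sn : m ∸ H (suc n) ≤ S n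
      rest≤Sn = m≤n+o⇒m∸n≤o m (H (suc n)) (subst (m ≤_) (+-comm (S n) _) m≤S)

  n≤partialSum : (∀ n → 1 ≤ H (suc n)) → ∀ n → n ≤ S n
  n≤partialSum pos zero    = z≤n
  n≤partialSum pos (suc n) = subst (_≤ S (suc n)) (+-comm n 1) (+-mono-≤ (n≤partialSum pos n) (pos n))

  brown⇒complete : (∀ n → 1 ≤ H (suc n)) → Brown H → Complete H
  brown⇒complete pos brown m _ with brown⇒distinctSum brown m m (n≤partialSum pos m)
  ... | is , range , distinct , sum≡ = is , All.map proj₁ range , distinct , sum≡

  sum≤top+sum-filter : ∀ n is → Unique is → All (_≤ suc n) is →
                       sum (map H is) ≤ H (suc n) + sum (map H (filter (_≤? n) is))
  sum≤top+sum-filter n []       []                  []              = z≤n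
  sum≤top+sum-filter n (i ∷ is) (i∉is ∷ distinct) (i≤1+n ∷ bounded) with i ≤? n
  ... | yes i≤n = begin
    H i + sum (map H is)                              ≤⟨ +-monoʳ-≤ (H i) (sum≤top+sum-filter n is distinct bounded) ⟩
    H i + (H (suc n) + sum (map H (filter (_≤? n) is))) ≡⟨ exchange (H i) (H (suc n)) _ ⟩
    H (suc n) + (H i + sum (map H (filter (_≤? n) is))) ≡⟨ cong (λ l → H (suc n) + sum (map H l)) (filter-accept (_≤? n) i≤n) ⟨
    H (suc n) + sum (map H (filter (_≤? n) (i ∷ is))) ∎
    where
      open ≤-Reasoning
      exchange : ∀ a b c → a + (b + c) ≡ b + (a + c)
      exchange = solve-∀
  ... | no i≰n = ≤-reflexive (begin
    H i + sum (map H is)                            ≡⟨ cong₂ (λ j l → H j + sum (map H l)) (sym i≡1+n) (filter-all (_≤? n) rest≤n) ⟨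
    H (suc n) + sum (map H (filter (_≤? n) is))       ≡⟨ cong (λ l → H (suc n) + sum (map H l)) (filter-reject (_≤? n) i≰n) ⟨
    H (suc n) + sum (map H (filter (_≤? n) (i ∷ is))) ∎)
    where
      open ≡-Reasoning
      i≡1+n : i ≡ suc n
      i≡1+n = ≤-antisym i≤1+n (≰⇒> i≰n)
      rest≤n : All (_≤ n) is
      rest≤n = All.map (λ (i≢j , j≤1+n) → ≤-pred (≤∧≢⇒< j≤1+n (λ j≡1+n → i≢j (trans i≡1+n (sym j≡1+n)))))
                       (All.zip (i∉is , bounded))

  sum-distinct≤partialSum : ∀ n is → Unique is → All (λ i → 1 ≤ i × i ≤ n) is → sum (map H is) ≤ S n
  sum-distinct≤partialSum zero    []      _ []                     = z≤n
  sum-distinct≤partialSum zero    (_ ∷ _) _ ((s≤s _ , ()) ∷ _)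
  sum-distinct≤partialSum (suc n) is distinct range = begin
    sum (map H is)                                     ≤⟨ sum≤top+sum-filter n is distinct (All.map proj₂ range) ⟩
    H (suc n) + sum (map H (filter (_≤? n) is))       ≤⟨ +-monoʳ-≤ (H (suc n)) (sum-distinct≤partialSum n (filter (_≤? n) is)
                                                           (Uniqueₚ.filter⁺ (_≤? n) distinct)
                                                           (All.zip (Allₚ.filter⁺ (_≤? n) (All.map proj₁ range) , Allₚ.all-filter (_≤? n) is))) ⟩
    H (suc n) + S n                                    ≡⟨ +-comm (H (suc n)) (S n) ⟩
    S (suc n)                                          ∎
    where open ≤-Reasoning

  -- 1 + S n is not a sum of distinct H i with i ≤ n, so its representation uses some H i ≥ H (1 + n).
  complete⇒brown : (∀ {m n} → m ≤ n → H m ≤ H n) → Complete H → Brown H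
  complete⇒brown mono complete n with complete (suc (S n)) (s≤s z≤n)
  ... | is , pos , distinct , sum≡ with All.all? (_≤? n) is
  ...   | yes small = contradiction (subst (_≤ S n) sum≡
                        (sum-distinct≤partialSum n is distinct (All.zip (pos , small)))) 1+n≰n
  ...   | no ¬small = subst (H (suc n) ≤_) sum≡
                        (Any≤⇒≤sum (Anyₚ.map⁺ (Any.map (λ i≰n → mono (≰⇒> i≰n)) (Allₚ.¬All⇒Any¬ (_≤? n) is ¬small))))

  brown-criterion : (∀ {m n} → m ≤ n → H m ≤ H n) → (∀ n → 1 ≤ H (suc n)) → Complete H ⇔ Brown H
  brown-criterion mono pos = mk⇔ (complete⇒brown mono) (brown⇒complete pos)

sum-zipWith-lagged : ∀ k N cs p →
  sum (zipWith _*_ (replicate k 0 ++ N ∷ []) (firstTerms cs p)) ≡ N * PLRS cs (p ∸ k)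
sum-zipWith-lagged zero    N cs zero    = sym (*-zeroʳ N)
sum-zipWith-lagged zero    N cs (suc p) = +-identityʳ _
sum-zipWith-lagged (suc k) N cs zero    = sym (*-zeroʳ N)
sum-zipWith-lagged (suc k) N cs (suc p) = sum-zipWith-lagged k N cs p

length-lagged : ∀ k N → length (replicate k 0 ++ N ∷ []) ≡ suc k
length-lagged zero    N = refl
length-lagged (suc k) N = cong suc (length-lagged k N)

length-firstTerms : ∀ cs n → length (firstTerms cs n) ≡ n
length-firstTerms cs zero    = refl
length-firstTerms cs (suc n) = cong suc (length-firstTerms cs n)

m≤n⇒[m<ᵇ1+n]≡true : ∀ {m n} → m ≤ n → (m <ᵇ suc n) ≡ true
m≤n⇒[m<ᵇ1+n]≡true z≤n       = refl
m≤n⇒[m<ᵇ1+n]≡true (s≤s m≤n) = m≤n⇒[m<ᵇ1+n]≡true m≤n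

n<m⇒[m<ᵇ1+n]≡false : ∀ {m n} → n < m → (m <ᵇ suc n) ≡ false
n<m⇒[m<ᵇ1+n]≡false {suc m} {zero}  _         = refl
n<m⇒[m<ᵇ1+n]≡false {suc m} {suc n} (s≤s n<m) = n<m⇒[m<ᵇ1+n]≡false n<m

module Sequence (k N : ℕ) where

  H : ℕ → ℕ
  H = PLRS (coeffs k N)

  S : ℕ → ℕ
  S = partialSum H

  K : ℕ
  K = suc (suc k)

  H-recurrence : ∀ n → H (suc (suc n)) ≡ H (suc n) + N * H (n ∸ k) + (if n <ᵇ suc k then 1 else 0)
  H-recurrence n = trans
    (cong₂ (λ lagged late → 1 * H (suc n) + lagged + (if late then 1 else 0))
           (sum-zipWith-lagged k N (coeffs k N) n)
           (cong₂ _<ᵇ_ (length-firstTerms (coeffs k N) n) (length-lagged k N)))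
    (cong (λ x → x + N * H (n ∸ k) + (if n <ᵇ suc k then 1 else 0)) (*-identityˡ _))

  H-suc-mono : ∀ n → H n ≤ H (suc n)
  H-suc-mono zero    = z≤n
  H-suc-mono (suc n) = ≤-trans (≤-trans (m≤m+n _ _) (m≤m+n _ _)) (≤-reflexive (sym (H-recurrence n)))

  H-mono : ∀ {m n} → m ≤ n → H m ≤ H n
  H-mono = stepwise-mono H H-suc-mono

  H-pos : ∀ n → 1 ≤ H (suc n)
  H-pos n = H-mono {1} {suc n} (s≤s z≤n)

  H-initial : ∀ i → i ≤ K → H i ≡ i
  H-initial zero                _           = refl
  H-initial (suc zero)          _           = refl
  H-initial (suc (suc n)) (s≤s 1+n≤1+k) = begin
    H (suc (suc n))                                             ≡⟨ H-recurrence n ⟩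
    H (suc n) + N * H (n ∸ k) + (if n <ᵇ suc k then 1 else 0)   ≡⟨ cong₂ (λ i late → H (suc n) + N * H i + (if late then 1 else 0))
                                                                      (m≤n⇒m∸n≡0 (≤-pred 1+n≤1+k)) (m≤n⇒[m<ᵇ1+n]≡true (≤-pred 1+n≤1+k)) ⟩
    H (suc n) + N * 0 + 1                                       ≡⟨ cong (λ h → h + N * 0 + 1) (H-initial (suc n) (m≤n⇒m≤1+n 1+n≤1+k)) ⟩
    suc n + N * 0 + 1                                           ≡⟨ x+N*0+1≡1+x (suc n) N ⟩
    suc (suc n)                                                 ∎
    where
      open ≡-Reasoning
      x+N*0+1≡1+x : ∀ x N → x + N * 0 + 1 ≡ suc x
      x+N*0+1≡1+x = solve-∀

  H-shift-suc : ∀ j → H (K + suc j) ≡ H (K + j) + N * H (suc j)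
  H-shift-suc j = begin
    H (K + suc j)                                                                 ≡⟨ cong H (+-suc K j) ⟩
    H (suc (K + j))                                                               ≡⟨ H-recurrence (suc (k + j)) ⟩
    H (K + j) + N * H (suc (k + j) ∸ k) + (if suc (k + j) <ᵇ suc k then 1 else 0) ≡⟨ cong₂ (λ i late → H (K + j) + N * H i + (if late then 1 else 0))
                                                                                         lag (n<m⇒[m<ᵇ1+n]≡false (s≤s (m≤m+n k j))) ⟩
    H (K + j) + N * H (suc j) + 0                                                 ≡⟨ +-identityʳ _ ⟩
    H (K + j) + N * H (suc j)                                                     ∎
    where
      open ≡-Reasoning
      lag : suc (k + j) ∸ k ≡ suc j
      lag = trans (cong (_∸ k) (sym (+-suc k j))) (m+n∸m≡n k (suc j))

  H-shift : ∀ j → H (K + j) ≡ K + N * S j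
  H-shift zero    = begin
    H (K + 0)  ≡⟨ cong H (+-identityʳ K) ⟩
    H K        ≡⟨ H-initial K ≤-refl ⟩
    K          ≡⟨ K≡K+N*0 K N ⟩
    K + N * 0  ∎
    where
      open ≡-Reasoning
      K≡K+N*0 : ∀ K N → K ≡ K + N * 0
      K≡K+N*0 = solve-∀
  H-shift (suc j) = begin
    H (K + suc j)                 ≡⟨ H-shift-suc j ⟩
    H (K + j) + N * H (suc j)     ≡⟨ cong (_+ N * H (suc j)) (H-shift j) ⟩
    K + N * S j + N * H (suc j)   ≡⟨ distrib K N (S j) (H (suc j)) ⟩
    K + N * S (suc j)             ∎
    where
      open ≡-Reasoning
      distrib : ∀ K N s h → K + N * s + N * h ≡ K + N * (s + h)
      distrib = solve-∀

  S-unfold : ∀ {a b} → a ≡ suc b → S a ≡ S b + H a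
  S-unfold refl = refl

  S-initial : ∀ n → n ≤ K → S n + S n ≡ n * suc n
  S-initial zero    _        = refl
  S-initial (suc n) 1+n≤K = begin
    (S n + H (suc n)) + (S n + H (suc n)) ≡⟨ cong (λ h → (S n + h) + (S n + h)) (H-initial (suc n) 1+n≤K) ⟩
    (S n + suc n) + (S n + suc n)         ≡⟨ regroup (S n) n ⟩
    (S n + S n) + (suc n + suc n)         ≡⟨ cong (_+ (suc n + suc n)) (S-initial n (≤-trans (n≤1+n n) 1+n≤K)) ⟩
    n * suc n + (suc n + suc n)           ≡⟨ triangle n ⟩
    suc n * suc (suc n)                   ∎
    where
      open ≡-Reasoning
      regroup : ∀ s n → (s + suc n) + (s + suc n) ≡ (s + s) + (suc n + suc n)
      regroup = solve-∀
      triangle : ∀ n → n * suc n + (suc n + suc n) ≡ suc n * suc (suc n)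
      triangle = solve-∀

  brown⇒bound : Brown H → N + N ≤ suc (S K)
  brown⇒bound brown = +-cancelˡ-≤ (H (suc K)) _ _ (begin
    H (suc K) + (N + N)        ≡⟨ cong (H (suc K) +_) (N+N≡N*2 N) ⟩
    H (suc K) + N * 2          ≡⟨ cong₂ (λ i h → H i + N * h) (+-comm K 1) (H-initial 2 (s≤s (s≤s z≤n))) ⟨
    H (K + 1) + N * H 2        ≡⟨ H-shift-suc 1 ⟨
    H (K + 2)                  ≡⟨ cong H (+-comm K 2) ⟩
    H (suc (suc K))            ≤⟨ brown (suc K) ⟩
    suc (S K + H (suc K))      ≡⟨ cong suc (+-comm (S K) (H (suc K))) ⟩
    suc (H (suc K) + S K)      ≡⟨ +-suc (H (suc K)) (S K) ⟨
    H (suc K) + suc (S K)      ∎)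
    where
      open ≤-Reasoning
      N+N≡N*2 : ∀ N → N + N ≡ N * 2
      N+N≡N*2 = solve-∀

-- For k = 0 and k = 1 the sum S K evaluates to 3 and 6.
large-N⇒2≤k : ∀ k N → suc (suc k) < N → N + N ≤ suc (Sequence.S k N (suc (suc k))) → 2 ≤ k
large-N⇒2≤k zero             N 3≤N bound = contradiction (≤-trans (+-mono-≤ 3≤N 3≤N) bound) (from-no (6 ≤? 4))
large-N⇒2≤k (suc zero)       N 4≤N bound = contradiction (≤-trans (+-mono-≤ 4≤N 4≤N) bound) (from-no (8 ≤? 7))
large-N⇒2≤k (suc (suc k)) _ _   _     = s≤s (s≤s z≤n)

module Sufficiency (k N : ℕ) (bound : N + N ≤ suc (Sequence.S k N (suc (suc k)))) where

  open Sequence k N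

  Bounded : ℕ → ℕ → Set
  Bounded a m = N * H m ≤ a + S (m + k)

  S-shift : ∀ j → S (K + suc j + k) ≡ S (K + j + k) + (K + N * S (suc (j + k)))
  S-shift j = trans (S-unfold (index₁ k j))
                    (cong (S (K + j + k) +_) (trans (cong H (index₂ k j)) (H-shift (suc (j + k)))))
    where
      index₁ : ∀ k j → suc (suc k) + suc j + k ≡ suc (suc (suc k) + j + k)
      index₁ = solve-∀
      index₂ : ∀ k j → suc (suc k) + suc j + k ≡ suc (suc k) + suc (j + k)
      index₂ = solve-∀

  shift-step : ∀ {a b} j → Bounded a (K + j) → Bounded b (suc j) →
               N * H (K + suc j) + K ≤ a + S (K + suc j + k) + N * b
  shift-step {a} {b} j bounded₁ bounded₂ = begin
    N * H (K + suc j) + K                                  ≡⟨ cong (λ h → N * h + K) (H-shift-suc j) ⟩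
    N * (H (K + j) + N * H (suc j)) + K                    ≡⟨ cong (_+ K) (*-distribˡ-+ N (H (K + j)) _) ⟩
    N * H (K + j) + N * (N * H (suc j)) + K                ≤⟨ +-monoˡ-≤ K (+-mono-≤ bounded₁ (*-monoʳ-≤ N bounded₂)) ⟩
    a + S (K + j + k) + N * (b + S (suc (j + k))) + K      ≡⟨ regroup a b N K (S (K + j + k)) (S (suc (j + k))) ⟩
    a + (S (K + j + k) + (K + N * S (suc (j + k)))) + N * b ≡⟨ cong (λ s → a + s + N * b) (S-shift j) ⟨
    a + S (K + suc j + k) + N * b                          ∎
    where
      open ≤-Reasoning
      regroup : ∀ a b N K x y → a + x + N * (b + y) + K ≡ a + (x + (K + N * y)) + N * b
      regroup = solve-∀

  S-K : S K ≡ S (suc k) + K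
  S-K = cong (S (suc k) +_) (H-initial K ≤-refl)

  S-lower : ∀ t → S K + t * suc N ≤ S (K + t)
  S-lower zero    = ≤-reflexive (trans (+-identityʳ (S K)) (cong S (sym (+-identityʳ K))))
  S-lower (suc t) = begin
    S K + suc t * suc N             ≡⟨ regroup (S K) N (t * suc N) ⟩
    (S K + t * suc N) + suc N       ≤⟨ +-mono-≤ (S-lower t) 1+N≤H ⟩
    S (K + t) + H (K + suc t)       ≡⟨ S-unfold (+-suc K t) ⟨
    S (K + suc t)                   ∎
    where
      open ≤-Reasoning
      regroup : ∀ s N x → s + (suc N + x) ≡ (s + x) + suc N
      regroup = solve-∀
      1+N≤H : suc N ≤ H (K + suc t)
      1+N≤H = ≤-trans (+-mono-≤ (s≤s z≤n) (≤-reflexive (sym (*-identityʳ N))))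
                      (≤-trans (≤-reflexive (sym (H-shift 1))) (H-mono (+-monoʳ-≤ K (s≤s z≤n))))

  Bounded-zero : ∀ {a} → Bounded a 0
  Bounded-zero = ≤-trans (≤-reflexive (*-zeroʳ N)) z≤n

  Bounded-one : Bounded 1 1
  Bounded-one = ≤-trans (≤-reflexive (*-identityʳ N)) (m+m≤1+[n+n]⇒m≤n (begin
    N + N                             ≤⟨ bound ⟩
    suc (S K)                         ≡⟨ cong suc S-K ⟩
    suc (S (suc k) + K)               ≤⟨ s≤s (+-monoʳ-≤ (S (suc k)) (s≤s (n≤partialSum H H-pos (suc k)))) ⟩
    suc (S (suc k) + suc (S (suc k))) ≤⟨ n≤1+n _ ⟩
    suc (suc (S (suc k)) + suc (S (suc k))) ∎))
    where open ≤-Reasoning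

  Bounded-one-strict : K < N → Bounded 0 1
  Bounded-one-strict K<N = ≤-trans (≤-reflexive (*-identityʳ N)) (+-cancelʳ-≤ N N (S (suc k)) (begin
    N + N                ≤⟨ bound ⟩
    suc (S K)            ≡⟨ cong suc S-K ⟩
    suc (S (suc k) + K)  ≡⟨ +-suc (S (suc k)) K ⟨
    S (suc k) + suc K    ≤⟨ +-monoʳ-≤ (S (suc k)) K<N ⟩
    S (suc k) + N        ∎))
    where open ≤-Reasoning

  Bounded-two : Bounded 1 2
  Bounded-two = ≤-trans (≤-reflexive N*H2≡N+N) bound
    where
      N*H2≡N+N : N * H 2 ≡ N + N
      N*H2≡N+N = trans (cong (N *_) (H-initial 2 (s≤s (s≤s z≤n)))) (N*2≡N+N N)
        where
          N*2≡N+N : ∀ N → N * 2 ≡ N + N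
          N*2≡N+N = solve-∀

  Bounded-initial : ∀ t → 3 + t ≤ K → Bounded 0 (3 + t)
  Bounded-initial t 3+t≤K = begin
    N * H (3 + t)            ≡⟨ cong (N *_) (H-initial (3 + t) 3+t≤K) ⟩
    N * (3 + t)              ≡⟨ split N t ⟩
    (N + N) + N * suc t      ≤⟨ +-monoˡ-≤ (N * suc t) bound ⟩
    suc (S K) + N * suc t    ≤⟨ m≤m+n _ t ⟩
    suc (S K) + N * suc t + t ≡⟨ merge (S K) N t ⟩
    S K + suc t * suc N      ≤⟨ S-lower (suc t) ⟩
    S (K + suc t)            ≡⟨ cong S (index k t) ⟩
    S (3 + t + k)            ∎
    where
      open ≤-Reasoning
      split : ∀ N t → N * (3 + t) ≡ (N + N) + N * suc t
      split = solve-∀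
      merge : ∀ s N t → suc s + N * suc t + t ≡ s + suc t * suc N
      merge = solve-∀
      index : ∀ k t → suc (suc k) + suc t ≡ 3 + t + k
      index = solve-∀

  S-K+suc : ∀ d → S K + H (K + suc d) ≤ S (K + suc d)
  S-K+suc d = ≤-trans (+-monoˡ-≤ (H (K + suc d)) (partialSum-mono H (m≤m+n K d)))
                      (≤-reflexive (sym (S-unfold (+-suc K d))))

  Bounded-K+2 : 2 ≤ k → Bounded 0 1 → Bounded 0 (K + 2)
  Bounded-K+2 (s≤s (s≤s {n = d} z≤n)) N≤S[1+k] = begin
    N * H (K + 2)                                                   ≡⟨ cong (N *_) H-K+2 ⟩
    N * ((K + N * 1) + N * 2)                                       ≤⟨ estimate N K (S K) (S (suc k)) (S k)
                                                                         (≤-trans (≤-reflexive (sym (*-identityʳ N))) N≤S[1+k])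
                                                                         bound K≤1+S[k] (s≤s z≤n) ⟩
    ((S K + (K + N * S k)) + (K + N * S (suc k))) + (K + N * S K)   ≤⟨ +-monoˡ-≤ _ (+-monoˡ-≤ _ S-K+k) ⟩
    (S (K + 0 + k) + (K + N * S (suc k))) + (K + N * S K)           ≡⟨ cong (_+ (K + N * S K)) (S-shift 0) ⟨
    S (K + 1 + k) + (K + N * S K)                                   ≡⟨ S-shift 1 ⟨
    S (K + 2 + k)                                                   ∎
    where
      open ≤-Reasoning
      H-K+2 : H (K + 2) ≡ (K + N * 1) + N * 2
      H-K+2 = trans (H-shift-suc 1) (cong₂ _+_ (H-shift 1) (cong (N *_) (H-initial 2 (s≤s (s≤s z≤n)))))
      K≤1+S[k] : K ≤ suc (S k)
      K≤1+S[k] = s≤s (+-mono-≤ (≤-trans (s≤s z≤n) (n≤partialSum H H-pos (suc d)))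
                               (≤-reflexive (sym (H-initial (suc (suc d)) (≤-trans (n≤1+n _) (n≤1+n _))))))
      S-K+k : S K + (K + N * S k) ≤ S (K + 0 + k)
      S-K+k = ≤-trans (≤-trans (≤-reflexive (cong (S K +_) (sym (H-shift k)))) (S-K+suc (suc d)))
                      (≤-reflexive (cong (λ i → S (i + k)) (sym (+-identityʳ K))))
      -- N K ≤ N (1 + s), N N ≤ N a and N (N + N) ≤ N (1 + X); the two spare copies of N are
      -- absorbed by 2N ≤ 1 + X ≤ X + 3K.
      estimate : ∀ N K X a s → N ≤ a → N + N ≤ suc X → K ≤ suc s → 1 ≤ K →
                 N * ((K + N * 1) + N * 2) ≤ ((X + (K + N * s)) + (K + N * a)) + (K + N * X)
      estimate N K X a s N≤a 2N≤1+X K≤1+s 1≤K = begin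
        N * ((K + N * 1) + N * 2)             ≡⟨ expand N K ⟩
        N * K + N * N + N * (N + N)           ≤⟨ +-mono-≤ (+-mono-≤ (≤-trans (*-monoʳ-≤ N K≤1+s) (≤-reflexive (*-suc N s))) (*-monoʳ-≤ N N≤a))
                                                          (≤-trans (*-monoʳ-≤ N 2N≤1+X) (≤-reflexive (*-suc N X))) ⟩
        (N + N * s) + N * a + (N + N * X)     ≡⟨ collect N s a X ⟩
        (N + N) + (N * s + N * a + N * X)     ≤⟨ +-monoˡ-≤ _ (≤-trans 2N≤1+X (≤-trans (≤-reflexive (+-comm 1 X)) (+-monoʳ-≤ X (≤-trans 1≤K (m≤m+n K (K + K)))))) ⟩
        (X + (K + (K + K))) + (N * s + N * a + N * X) ≡⟨ distribute X K N s a ⟩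
        ((X + (K + N * s)) + (K + N * a)) + (K + N * X) ∎
        where
          expand : ∀ N K → N * ((K + N * 1) + N * 2) ≡ N * K + N * N + N * (N + N)
          expand = solve-∀
          collect : ∀ N s a X → (N + N * s) + N * a + (N + N * X) ≡ (N + N) + (N * s + N * a + N * X)
          collect = solve-∀
          distribute : ∀ X K N s a → (X + (K + (K + K))) + (N * s + N * a + N * X) ≡ ((X + (K + N * s)) + (K + N * a)) + (K + N * X)
          distribute = solve-∀

  bounded-small-N : N ≤ K → ∀ m → Bounded 1 m
  bounded-small-N N≤K = lagged-induction (suc k) (Bounded 1) initial step
    where
      initial : ∀ m → m ≤ K → Bounded 1 m
      initial zero                _     = Bounded-zero
      initial (suc zero)          _     = Bounded-one
      initial (suc (suc zero))    _     = Bounded-two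
      initial (suc (suc (suc t))) 3+t≤K = m≤n⇒m≤1+n (Bounded-initial t 3+t≤K)
      step : ∀ j → Bounded 1 (K + j) → Bounded 1 (suc j) → Bounded 1 (K + suc j)
      step j bounded₁ bounded₂ = +-cancelʳ-≤ K _ _
        (≤-trans (shift-step {1} {1} j bounded₁ bounded₂) (+-monoʳ-≤ _ (≤-trans (≤-reflexive (*-identityʳ N)) N≤K)))

  bounded-large-N : K < N → ∀ m → m ≢ 2 → Bounded 0 m
  bounded-large-N K<N = lagged-induction (suc k) (λ m → m ≢ 2 → Bounded 0 m) initial step
    where
      2≤k : 2 ≤ k
      2≤k = large-N⇒2≤k k N K<N bound
      K+j≢2 : ∀ j → K + j ≢ 2
      K+j≢2 j = >⇒≢ (≤-trans (s≤s (s≤s (≤-trans (s≤s z≤n) 2≤k))) (m≤m+n K j))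
      strict-step : ∀ j → Bounded 0 (K + j) → Bounded 0 (suc j) → Bounded 0 (K + suc j)
      strict-step j bounded₁ bounded₂ = m+n≤o⇒m≤o _
        (≤-trans (shift-step {0} {0} j bounded₁ bounded₂) (≤-reflexive (trans (cong (S (K + suc j + k) +_) (*-zeroʳ N)) (+-identityʳ _))))
      initial : ∀ m → m ≤ K → m ≢ 2 → Bounded 0 m
      initial zero                _     _   = Bounded-zero
      initial (suc zero)          _     _   = Bounded-one-strict K<N
      initial (suc (suc zero))    _     2≢2 = contradiction refl 2≢2
      initial (suc (suc (suc t))) 3+t≤K _   = Bounded-initial t 3+t≤K
      step : ∀ j → (K + j ≢ 2 → Bounded 0 (K + j)) → (suc j ≢ 2 → Bounded 0 (suc j)) →
             K + suc j ≢ 2 → Bounded 0 (K + suc j)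
      step zero          bounded₁ bounded₂ _ = strict-step 0 (bounded₁ (K+j≢2 0)) (bounded₂ λ ())
      step (suc zero)    _        _        _ = Bounded-K+2 2≤k (Bounded-one-strict K<N)
      step (suc (suc j)) bounded₁ bounded₂ _ = strict-step (suc (suc j)) (bounded₁ (K+j≢2 (suc (suc j)))) (bounded₂ λ ())

  bounded : ∀ m → Bounded 1 m
  bounded m with N ≤? K
  ... | yes N≤K = bounded-small-N N≤K m
  ... | no  N≰K with m ≟ 2
  ...   | yes refl = Bounded-two
  ...   | no  m≢2  = m≤n⇒m≤1+n (bounded-large-N (≰⇒> N≰K) m m≢2)

  brown : Brown H
  brown n with ≤⊎≡+suc (suc k) n
  ... | inj₁ n≤1+k      = ≤-trans (≤-reflexive (H-initial (suc n) (s≤s n≤1+k))) (s≤s (n≤partialSum H H-pos n))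
  ... | inj₂ (d , refl) = begin
    H (K + suc d)                    ≡⟨ H-shift-suc d ⟩
    H (K + d) + N * H (suc d)        ≤⟨ +-monoʳ-≤ (H (K + d)) (bounded (suc d)) ⟩
    H (K + d) + suc (S (suc d + k))  ≡⟨ +-suc (H (K + d)) _ ⟩
    suc (H (K + d) + S (suc d + k))  ≡⟨ cong suc (+-comm (H (K + d)) _) ⟩
    suc (S (suc (d + k)) + H (K + d)) ≡⟨ cong (λ i → suc (S (suc i) + H (K + d))) (+-comm d k) ⟩
    suc (S (K + d))                  ≡⟨ cong (λ i → suc (S (suc i))) (+-suc k d) ⟨
    suc (S (suc k + suc d))          ∎
    where open ≤-Reasoning

brown⇔bound : ∀ k N → Brown (Sequence.H k N) ⇔ N + N ≤ suc (Sequence.S k N (suc (suc k)))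
brown⇔bound k N = mk⇔ (Sequence.brown⇒bound k N) (λ bound → Sufficiency.brown k N bound)

mainTheorem5 : (k N : ℕ) → 1 ≤ N →
    Complete (PLRS (coeffs k N)) ⇔ (1 ≤ N × N ≤ ceil4 ((k + 2) * (k + 3)))
mainTheorem5 k N 1≤N = mk⇔ (λ complete → 1≤N , Equivalence.to criterion complete)
                           (λ (_ , N≤⌈⌉) → Equivalence.from criterion N≤⌈⌉)
  where
    open Sequence k N
    triangular : S K + S K ≡ (k + 2) * (k + 3)
    triangular = trans (S-initial K ≤-refl) (K[K+1]≡[k+2][k+3] k)
      where
        K[K+1]≡[k+2][k+3] : ∀ k → suc (suc k) * suc (suc (suc k)) ≡ (k + 2) * (k + 3)
        K[K+1]≡[k+2][k+3] = solve-∀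
    criterion : Complete H ⇔ N ≤ ceil4 ((k + 2) * (k + 3))
    criterion = ⇔.trans (brown-criterion H H-mono H-pos)
                (⇔.trans (brown⇔bound k N)
                  (⇔.sym (subst (λ P → N ≤ ceil4 P ⇔ N + N ≤ suc (S K)) triangular (≤ceil4-double⇔ N (S K)))))
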